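{- Let $m, n \geq 4$ be even integers. Then there exists a shiftable $SMA(m,n)$ such that for every $x \in \{1, 2, 3, \ldots, mn/2\}$ the entries $x$ and $-x$ appear in the same row.
   Context: For positive integers $m,n$ with $mn$ even, a (tight) signed magic array $SMA(m,n)$ is an $m \times n$ array with no empty cells whose entries are the elements of $X=\{\pm 1, \pm 2, \ldots, \pm mn/2\}$, each element of $X$ appearing exactly once, such that the entries of every row and of every column sum to $0$. An $SMA(m,n)$ is called shiftable if every row and every column contains the same number of positive entries as negative entries. -}

module Defs where

open import Data.Nat using (ℕ; zero; suc; _*_; _/_; _≤_)
open import Data.Nat.Divisibility using (_∣_)
open import Data.Integer as ℤ using (ℤ; +_; 0ℤ; _<_; ∣_∣)
open import Data.Integer.Properties using (_<?_)
open import Data.Fin using (Fin; zero; suc)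
open import Data.Product using (_×_; _,_; Σ; ∃; ∃-syntax)
open import Relation.Nullary using (¬_; yes; no)
open import Relation.Binary.PropositionalEquality using (_≡_)

sumℤ : ∀ {n} → (Fin n → ℤ) → ℤ
sumℤ {zero}  f = 0ℤ
sumℤ {suc n} f = f zero ℤ.+ sumℤ (λ i → f (suc i))

#pos : ∀ {n} → (Fin n → ℤ) → ℕ
#pos {zero}  f = 0
#pos {suc n} f with 0ℤ <? f zero
... | yes _ = suc (#pos (λ i → f (suc i)))
... | no  _ = #pos (λ i → f (suc i))

#neg : ∀ {n} → (Fin n → ℤ) → ℕ
#neg {zero}  f = 0
#neg {suc n} f with f zero <? 0ℤ
... | yes _ = suc (#neg (λ i → f (suc i)))
... | no  _ = #neg (λ i → f (suc i))

Array : ℕ → ℕ → Set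
Array m n = Fin m → Fin n → ℤ

InX : ℕ → ℕ → ℤ → Set
InX m n z = ¬ (z ≡ 0ℤ) × ∣ z ∣ ≤ (m * n) / 2

record IsSMA (m n : ℕ) (A : Array m n) : Set where
  field
    mn-even    : 2 ∣ m * n
    entries-in : ∀ i j → InX m n (A i j)
    injective  : ∀ i j i′ j′ → A i j ≡ A i′ j′ → (i ≡ i′) × (j ≡ j′)
    covers     : ∀ z → InX m n z → ∃[ i ] ∃[ j ] (A i j ≡ z)
    row-sum    : ∀ i → sumℤ (λ j → A i j) ≡ 0ℤ
    col-sum    : ∀ j → sumℤ (λ i → A i j) ≡ 0ℤ

IsShiftable : ∀ {m n} → Array m n → Set
IsShiftable {m} {n} A =
  (∀ i → #pos (λ j → A i j) ≡ #neg (λ j → A i j)) ×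
  (∀ j → #pos (λ i → A i j) ≡ #neg (λ i → A i j))

-- Encode the entry ±(k + 1) as a sign together with k : Fin h.  A block is an array whose cells
-- are in bijection with the 2h entries and each of whose lines has as many positive as negative
-- entries and sums to zero.  Putting two blocks side by side, after raising the magnitudes of the
-- second by h₁, gives a block again: raising keeps the sign counts of a line and adds h₁ times
-- the (equal) counts to both its positive and its negative mass.  Transposition turns this into
-- stacking, and neither operation separates x from -x when they share a row.  Four-row strips are
-- then built from 4×2 blocks; six-row strips need 6×4 and 6×6 blocks, because in a 6×2 block with
-- ±x in a common row each column would have to split 1 + ⋯ + 6 = 21 into equal halves.
{-# OPTIONS --safe #-}
module Submission where

open import Defs
open import Data.Nat using (ℕ; _≤_; _*_; _/_)
open import Data.Nat.Divisibility using (_∣_)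
open import Data.Integer using (+_; -_)
open import Data.Fin using (Fin)
open import Data.Product using (_×_; Σ; ∃-syntax)
open import Relation.Binary.PropositionalEquality using (_≡_)

open import Agda.Builtin.FromNat using (Number)
open import Agda.Builtin.FromNeg using (Negative)
open import Data.Bool as Bool using (Bool; true; false)
open import Data.Empty using (⊥-elim)
open import Data.Fin as Fin using (zero; suc; toℕ; _↑ˡ_; _↑ʳ_; splitAt)
open import Data.Fin.Properties
  using (splitAt⁻¹-↑ˡ; splitAt⁻¹-↑ʳ; splitAt-↑ˡ; splitAt-↑ʳ; toℕ-↑ˡ; toℕ-↑ʳ; all?; any?; toℕ-injective; toℕ<n; toℕ-fromℕ<)
open import Data.Integer as ℤ using (ℤ; -[1+_]; 0ℤ; ∣_∣)
open import Data.Integer.Literals as ℤLiterals using ()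
open import Data.Integer.Properties as ℤ using ()
import Data.Integer.Tactic.RingSolver as ℤSolver
open import Data.Maybe as Maybe using (Maybe; nothing; from-just)
open import Data.Maybe.Effectful as Maybe using ()
open import Data.Nat as ℕ using (zero; suc; _+_; _<?_; s≤s)
open import Data.Nat.DivMod using (m*n/n≡m)
open import Data.Nat.Divisibility using (divides; ∣m⇒∣m*n)
open import Data.Nat.Literals as ℕLiterals using ()
open import Data.Nat.Properties as ℕ using ()
open import Data.Nat.Tactic.RingSolver using (solve-∀)
open import Algebra.Properties.Semiring.Sum ℕ.+-*-semiring using (sum; sum-cong-≗; ∑-distrib-+; *-distribˡ-sum)
open import Data.Product using (_,_; proj₁; proj₂; map₂; swap; uncurry)
open import Data.Product.Properties using (≡-dec; ,-injective)
open import Data.Sum using (inj₁; inj₂; [_,_]′)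
open import Data.Sum.Properties using ([,]-map)
open import Data.Unit using (⊤; tt)
open import Data.Vec using (Vec; _∷_; []; lookup)
open import Data.Vec.Effectful using (module TraversableA)
open import Data.Vec.Functional using (Vector; _++_)
open import Data.Vec.Functional.Properties using (lookup-++ˡ; lookup-++ʳ)
open import Function using (_∘_; flip)
open import Relation.Binary.Definitions using (DecidableEquality)
open import Relation.Binary.PropositionalEquality using (refl; sym; trans; cong; cong₂; subst; _≗_; module ≡-Reasoning)
open import Relation.Nullary using (¬_)
open import Relation.Nullary.Decidable using (Dec; yes; no; map′; _×-dec_; dec⇒maybe; from-yes)
open import Relation.Unary using (Decidable)

-- (true , k) stands for the value k + 1 and (false , k) for -(k + 1).
Entry : ℕ → Set
Entry h = Bool × Fin h

variable
  A : Set
  m n m₁ m₂ n₁ n₂ h h₁ h₂ m′ n′ h′ : ℕ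

magnitude : Entry h → ℕ
magnitude (_ , k) = suc (toℕ k)

indicator : Bool → Bool → ℕ
indicator true  true  = 1
indicator false false = 1
indicator _     _     = 0

count mass : Bool → Entry h → ℕ
count s e = indicator s (proj₁ e)
mass  s e = count s e * magnitude e

SignSymmetric : (Bool → A → ℕ) → Vector A n → Set
SignSymmetric w v = sum (w true ∘ v) ≡ sum (w false ∘ v)

-- Equal counts make the line shiftable; equal masses make it sum to zero.
record Balanced (v : Vector (Entry h) n) : Set where
  constructor balanced
  field
    counts : SignSymmetric count v
    masses : SignSymmetric mass v

sum-++ : (f : A → ℕ) (u : Vector A m) (v : Vector A n) →
         sum (f ∘ (u ++ v)) ≡ sum (f ∘ u) + sum (f ∘ v)
sum-++ {m = zero}  f u v = refl
sum-++ {m = suc m} f u v = begin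
  f (u zero) + sum (f ∘ (u ++ v) ∘ suc)          ≡⟨ cong (f (u zero) ℕ.+_) (sum-cong-≗ (cong f ∘ [,]-map ∘ splitAt m)) ⟩
  f (u zero) + sum (f ∘ ((u ∘ suc) ++ v))        ≡⟨ cong (f (u zero) ℕ.+_) (sum-++ f (u ∘ suc) v) ⟩
  f (u zero) + (sum (f ∘ u ∘ suc) + sum (f ∘ v)) ≡⟨ sym (ℕ.+-assoc (f (u zero)) _ _) ⟩
  sum (f ∘ u) + sum (f ∘ v)                      ∎
  where open ≡-Reasoning

module _ (w : Bool → A → ℕ) where

  signSymmetric-cong : {u v : Vector A n} → u ≗ v → SignSymmetric w u → SignSymmetric w v
  signSymmetric-cong u≗v sym-u =
    trans (sym (sum-cong-≗ (cong (w true) ∘ u≗v))) (trans sym-u (sum-cong-≗ (cong (w false) ∘ u≗v)))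

  signSymmetric-++ : {u : Vector A m} {v : Vector A n} →
                     SignSymmetric w u → SignSymmetric w v → SignSymmetric w (u ++ v)
  signSymmetric-++ {u = u} {v} sym-u sym-v =
    trans (sum-++ (w true) u v) (trans (cong₂ _+_ sym-u sym-v) (sym (sum-++ (w false) u v)))

balanced-cong : {u v : Vector (Entry h) n} → u ≗ v → Balanced u → Balanced v
balanced-cong {u = u} {v} u≗v (balanced counts masses) = balanced
  (signSymmetric-cong count {u = u} {v} u≗v counts) (signSymmetric-cong mass {u = u} {v} u≗v masses)

balanced-++ : {u : Vector (Entry h) m} {v : Vector (Entry h) n} → Balanced u → Balanced v → Balanced (u ++ v)
balanced-++ {u = u} {v} (balanced countsᵘ massesᵘ) (balanced countsᵛ massesᵛ) = balanced
  (signSymmetric-++ count {u = u} {v} countsᵘ countsᵛ) (signSymmetric-++ mass {u = u} {v} massesᵘ massesᵛ)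

module _ (f : Entry h₁ → Entry h₂) (c : ℕ)
         (sign-f : ∀ e → proj₁ (f e) ≡ proj₁ e) (magnitude-f : ∀ e → magnitude (f e) ≡ c + magnitude e) where

  count-relabel : ∀ s (e : Entry h₁) → count s (f e) ≡ count s e
  count-relabel s e = cong (indicator s) (sign-f e)

  mass-relabel : ∀ s (e : Entry h₁) → mass s (f e) ≡ c * count s e + mass s e
  mass-relabel s e = begin
    count s (f e) * magnitude (f e)  ≡⟨ cong₂ _*_ (count-relabel s e) (magnitude-f e) ⟩
    count s e * (c + magnitude e)    ≡⟨ distrib (count s e) c (magnitude e) ⟩
    c * count s e + mass s e         ∎
    where
    open ≡-Reasoning
    distrib : ∀ a c x → a * (c + x) ≡ c * a + a * x
    distrib = solve-∀

  sum-mass-relabel : ∀ s (v : Vector (Entry h₁) n) → sum (mass s ∘ f ∘ v) ≡ c * sum (count s ∘ v) + sum (mass s ∘ v)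
  sum-mass-relabel s v = begin
    sum (mass s ∘ f ∘ v)                                 ≡⟨ sum-cong-≗ (mass-relabel s ∘ v) ⟩
    sum (λ i → c * count s (v i) + mass s (v i))         ≡⟨ ∑-distrib-+ (λ i → c * count s (v i)) (mass s ∘ v) ⟩
    sum (λ i → c * count s (v i)) + sum (mass s ∘ v)     ≡⟨ cong (_+ sum (mass s ∘ v)) (sym (*-distribˡ-sum c (count s ∘ v))) ⟩
    c * sum (count s ∘ v) + sum (mass s ∘ v)             ∎
    where open ≡-Reasoning

  balanced-relabel : {v : Vector (Entry h₁) n} → Balanced v → Balanced (f ∘ v)
  balanced-relabel {v = v} (balanced counts masses) = balanced
    (trans (sum-cong-≗ (count-relabel true ∘ v)) (trans counts (sym (sum-cong-≗ (count-relabel false ∘ v)))))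
    (trans (sum-mass-relabel true v) (trans (cong₂ (λ a b → c * a + b) counts masses) (sym (sum-mass-relabel false v))))

data Split (m n : ℕ) : Fin (m + n) → Set where
  left  : (i : Fin m) → Split m n (i ↑ˡ n)
  right : (j : Fin n) → Split m n (m ↑ʳ j)

split : ∀ m n (k : Fin (m + n)) → Split m n k
split m n k with splitAt m k in eq
... | inj₁ i = subst (Split m n) (splitAt⁻¹-↑ˡ eq) (left i)
... | inj₂ j = subst (Split m n) (splitAt⁻¹-↑ʳ eq) (right j)

liftˡ : ∀ h₂ → Entry h₁ → Entry (h₁ + h₂)
liftˡ h₂ (s , k) = s , k ↑ˡ h₂

liftʳ : ∀ h₁ → Entry h₂ → Entry (h₁ + h₂)
liftʳ h₁ (s , k) = s , h₁ ↑ʳ k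

balanced-liftˡ : {v : Vector (Entry h₁) n} → Balanced v → Balanced (liftˡ h₂ ∘ v)
balanced-liftˡ {h₂ = h₂} = balanced-relabel (liftˡ h₂) 0 (λ _ → refl) (λ (_ , k) → cong suc (toℕ-↑ˡ k h₂))

balanced-liftʳ : {v : Vector (Entry h₂) n} → Balanced v → Balanced (liftʳ h₁ ∘ v)
balanced-liftʳ {h₁ = h₁} =
  balanced-relabel (liftʳ h₁) h₁ (λ _ → refl) (λ (_ , k) → trans (cong suc (toℕ-↑ʳ h₁ k)) (sym (ℕ.+-suc h₁ (toℕ k))))

record Block (m n h : ℕ) : Set where
  field
    entry           : Fin m → Fin n → Entry h
    position        : Entry h → Fin m × Fin n
    position-entry  : ∀ i j → position (entry i j) ≡ (i , j)
    entry-position  : ∀ e → uncurry entry (position e) ≡ e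
    row-balanced    : ∀ i → Balanced (entry i)
    column-balanced : ∀ j → Balanced (λ i → entry i j)

  row : Entry h → Fin m
  row = proj₁ ∘ position

  column : Entry h → Fin n
  column = proj₂ ∘ position

open Block

RowPaired : Block m n h → Set
RowPaired {h = h} B = ∀ (k : Fin h) → row B (true , k) ≡ row B (false , k)

ColumnPaired : Block m n h → Set
ColumnPaired {h = h} B = ∀ (k : Fin h) → column B (true , k) ≡ column B (false , k)

transpose : Block m n h → Block n m h
transpose B = record
  { entry           = λ j i → entry B i j
  ; position        = swap ∘ position B
  ; position-entry  = λ j i → cong swap (position-entry B i j)
  ; entry-position  = entry-position B
  ; row-balanced    = column-balanced B
  ; column-balanced = row-balanced B
  }

module Beside (B₁ : Block m n₁ h₁) (B₂ : Block m n₂ h₂) where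

  entryᴮ : Fin m → Fin (n₁ + n₂) → Entry (h₁ + h₂)
  entryᴮ i = (liftˡ h₂ ∘ entry B₁ i) ++ (liftʳ h₁ ∘ entry B₂ i)

  positionᴮ : Entry (h₁ + h₂) → Fin m × Fin (n₁ + n₂)
  positionᴮ (s , k) = [ map₂ (_↑ˡ n₂) ∘ position B₁ ∘ (s ,_) , map₂ (n₁ ↑ʳ_) ∘ position B₂ ∘ (s ,_) ]′ (splitAt h₁ k)

  entry-↑ˡ : ∀ i j → entryᴮ i (j ↑ˡ n₂) ≡ liftˡ h₂ (entry B₁ i j)
  entry-↑ˡ i = lookup-++ˡ (liftˡ h₂ ∘ entry B₁ i) (liftʳ h₁ ∘ entry B₂ i)

  entry-↑ʳ : ∀ i j → entryᴮ i (n₁ ↑ʳ j) ≡ liftʳ h₁ (entry B₂ i j)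
  entry-↑ʳ i = lookup-++ʳ (liftˡ h₂ ∘ entry B₁ i) (liftʳ h₁ ∘ entry B₂ i)

  position-liftˡ : ∀ e → positionᴮ (liftˡ h₂ e) ≡ map₂ (_↑ˡ n₂) (position B₁ e)
  position-liftˡ (s , k) = cong [ _ , _ ]′ (splitAt-↑ˡ h₁ k h₂)

  position-liftʳ : ∀ e → positionᴮ (liftʳ h₁ e) ≡ map₂ (n₁ ↑ʳ_) (position B₂ e)
  position-liftʳ (s , k) = cong [ _ , _ ]′ (splitAt-↑ʳ h₁ h₂ k)

  positionᴮ-entry : ∀ i j → positionᴮ (entryᴮ i j) ≡ (i , j)
  positionᴮ-entry i j with split n₁ n₂ j
  ... | left j₁ = begin
    positionᴮ (entryᴮ i (j₁ ↑ˡ n₂))             ≡⟨ cong positionᴮ (entry-↑ˡ i j₁) ⟩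
    positionᴮ (liftˡ h₂ (entry B₁ i j₁))        ≡⟨ position-liftˡ (entry B₁ i j₁) ⟩
    map₂ (_↑ˡ n₂) (position B₁ (entry B₁ i j₁)) ≡⟨ cong (map₂ (_↑ˡ n₂)) (position-entry B₁ i j₁) ⟩
    (i , j₁ ↑ˡ n₂)                              ∎
    where open ≡-Reasoning
  ... | right j₂ = begin
    positionᴮ (entryᴮ i (n₁ ↑ʳ j₂))             ≡⟨ cong positionᴮ (entry-↑ʳ i j₂) ⟩
    positionᴮ (liftʳ h₁ (entry B₂ i j₂))        ≡⟨ position-liftʳ (entry B₂ i j₂) ⟩
    map₂ (n₁ ↑ʳ_) (position B₂ (entry B₂ i j₂)) ≡⟨ cong (map₂ (n₁ ↑ʳ_)) (position-entry B₂ i j₂) ⟩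
    (i , n₁ ↑ʳ j₂)                              ∎
    where open ≡-Reasoning

  entryᴮ-position : ∀ e → uncurry entryᴮ (positionᴮ e) ≡ e
  entryᴮ-position (s , k) with split h₁ h₂ k
  ... | left k₁ = begin
    uncurry entryᴮ (positionᴮ (liftˡ h₂ (s , k₁)))           ≡⟨ cong (uncurry entryᴮ) (position-liftˡ (s , k₁)) ⟩
    uncurry entryᴮ (map₂ (_↑ˡ n₂) (position B₁ (s , k₁)))    ≡⟨ entry-↑ˡ (row B₁ (s , k₁)) (column B₁ (s , k₁)) ⟩
    liftˡ h₂ (uncurry (entry B₁) (position B₁ (s , k₁)))     ≡⟨ cong (liftˡ h₂) (entry-position B₁ (s , k₁)) ⟩
    (s , k₁ ↑ˡ h₂)                                           ∎
    where open ≡-Reasoning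
  ... | right k₂ = begin
    uncurry entryᴮ (positionᴮ (liftʳ h₁ (s , k₂)))           ≡⟨ cong (uncurry entryᴮ) (position-liftʳ (s , k₂)) ⟩
    uncurry entryᴮ (map₂ (n₁ ↑ʳ_) (position B₂ (s , k₂)))    ≡⟨ entry-↑ʳ (row B₂ (s , k₂)) (column B₂ (s , k₂)) ⟩
    liftʳ h₁ (uncurry (entry B₂) (position B₂ (s , k₂)))     ≡⟨ cong (liftʳ h₁) (entry-position B₂ (s , k₂)) ⟩
    (s , h₁ ↑ʳ k₂)                                           ∎
    where open ≡-Reasoning

  column-balancedᴮ : ∀ j → Balanced (λ i → entryᴮ i j)
  column-balancedᴮ j with split n₁ n₂ j
  ... | left j₁  = balanced-cong (sym ∘ flip entry-↑ˡ j₁) (balanced-liftˡ (column-balanced B₁ j₁))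
  ... | right j₂ = balanced-cong (sym ∘ flip entry-↑ʳ j₂) (balanced-liftʳ (column-balanced B₂ j₂))

  beside : Block m (n₁ + n₂) (h₁ + h₂)
  beside = record
    { entry           = entryᴮ
    ; position        = positionᴮ
    ; position-entry  = positionᴮ-entry
    ; entry-position  = entryᴮ-position
    ; row-balanced    = λ i → balanced-++ (balanced-liftˡ (row-balanced B₁ i)) (balanced-liftʳ (row-balanced B₂ i))
    ; column-balanced = column-balancedᴮ
    }

  beside-rowPaired : RowPaired B₁ → RowPaired B₂ → RowPaired beside
  beside-rowPaired paired₁ paired₂ k with split h₁ h₂ k
  ... | left k₁  = trans (cong proj₁ (position-liftˡ (true , k₁)))
                         (trans (paired₁ k₁) (sym (cong proj₁ (position-liftˡ (false , k₁)))))
  ... | right k₂ = trans (cong proj₁ (position-liftʳ (true , k₂)))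
                         (trans (paired₂ k₂) (sym (cong proj₁ (position-liftʳ (false , k₂)))))

  beside-columnPaired : ColumnPaired B₁ → ColumnPaired B₂ → ColumnPaired beside
  beside-columnPaired paired₁ paired₂ k with split h₁ h₂ k
  ... | left k₁  = trans (cong proj₂ (position-liftˡ (true , k₁)))
                         (trans (cong (_↑ˡ n₂) (paired₁ k₁)) (sym (cong proj₂ (position-liftˡ (false , k₁)))))
  ... | right k₂ = trans (cong proj₂ (position-liftʳ (true , k₂)))
                         (trans (cong (n₁ ↑ʳ_) (paired₂ k₂)) (sym (cong proj₂ (position-liftʳ (false , k₂)))))

open Beside using (beside; beside-rowPaired; beside-columnPaired)

above : Block m₁ n h₁ → Block m₂ n h₂ → Block (m₁ + m₂) n (h₁ + h₂)
above B₁ B₂ = transpose (beside (transpose B₁) (transpose B₂))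

above-rowPaired : (B₁ : Block m₁ n h₁) (B₂ : Block m₂ n h₂) → RowPaired B₁ → RowPaired B₂ → RowPaired (above B₁ B₂)
above-rowPaired B₁ B₂ = beside-columnPaired (transpose B₁) (transpose B₂)

PairedBlock : ℕ → ℕ → ℕ → Set
PairedBlock m n h = Σ (Block m n h) RowPaired

_≟ₑ_ : DecidableEquality (Entry h)
_≟ₑ_ = ≡-dec Bool._≟_ Fin._≟_

all-entries? : {P : Entry h → Set} → Decidable P → Dec (∀ e → P e)
all-entries? P? = map′ (λ (pos , neg) → λ { (true , k) → pos k ; (false , k) → neg k })
                       (λ all → all ∘ (true ,_) , all ∘ (false ,_))
                       (all? (P? ∘ (true ,_)) ×-dec all? (P? ∘ (false ,_)))

balanced? : (v : Vector (Entry h) n) → Dec (Balanced v)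
balanced? v = map′ (uncurry balanced) (λ b → Balanced.counts b , Balanced.masses b)
                   ((sum (count true ∘ v) ℕ.≟ sum (count false ∘ v)) ×-dec (sum (mass true ∘ v) ℕ.≟ sum (mass false ∘ v)))

module Table (T : Vec (Vec (Entry h) n) m) where

  entryᵀ : Fin m → Fin n → Entry h
  entryᵀ i j = lookup (lookup T i) j

  Covering : Set
  Covering = ∀ e → ∃[ i ] ∃[ j ] entryᵀ i j ≡ e

  covering? : Dec Covering
  covering? = all-entries? (λ e → any? (λ i → any? (λ j → entryᵀ i j ≟ₑ e)))

  module _ (covering : Covering) where

    positionᵀ : Entry h → Fin m × Fin n
    positionᵀ e = proj₁ (covering e) , proj₁ (proj₂ (covering e))

    Valid : Set
    Valid = (∀ i j → positionᵀ (entryᵀ i j) ≡ (i , j)) ×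
            (∀ i → Balanced (entryᵀ i)) × (∀ j → Balanced (λ i → entryᵀ i j)) ×
            (∀ k → proj₁ (positionᵀ (true , k)) ≡ proj₁ (positionᵀ (false , k)))

    valid? : Dec Valid
    valid? = all? (λ i → all? (λ j → ≡-dec Fin._≟_ Fin._≟_ (positionᵀ (entryᵀ i j)) (i , j))) ×-dec
             all? (λ i → balanced? (entryᵀ i)) ×-dec all? (λ j → balanced? (λ i → entryᵀ i j)) ×-dec
             all? (λ k → proj₁ (positionᵀ (true , k)) Fin.≟ proj₁ (positionᵀ (false , k)))

    pairedBlock : Valid → PairedBlock m n h
    pairedBlock (position-entry , rows , columns , paired) = record
      { entry           = entryᵀ
      ; position        = positionᵀ
      ; position-entry  = position-entry
      ; entry-position  = λ e → proj₂ (proj₂ (covering e))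
      ; row-balanced    = rows
      ; column-balanced = columns
      } , paired

fromℤ : ℤ → Maybe (Entry h)
fromℤ (+ zero)       = nothing
fromℤ {h} (+ suc k)  = Maybe.map (λ k<h → true , Fin.fromℕ< k<h) (dec⇒maybe (k <? h))
fromℤ {h} -[1+ k ]   = Maybe.map (λ k<h → false , Fin.fromℕ< k<h) (dec⇒maybe (k <? h))

decodeTable : ∀ h → Vec (Vec ℤ n) m → Maybe (Vec (Vec (Entry h) n) m)
decodeTable h = mapA (mapA fromℤ)
  where open TraversableA Maybe.applicative

module IntegerLiterals where
  instance
    ℕ-number : Number ℕ
    ℕ-number = ℕLiterals.number
    ℤ-number : Number ℤ
    ℤ-number = ℤLiterals.number
    ℤ-negative : Negative ℤ
    ℤ-negative = ℤLiterals.negative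
    trivial : ⊤
    trivial = tt
  open import Agda.Builtin.FromNat public using (fromNat)
  open import Agda.Builtin.FromNeg public using (fromNeg)

-- Each base block is verified by evaluation: from-just and from-yes only have the required types
-- when the decoding succeeds and the decisions on these closed tables evaluate to yes.
block4×2 : PairedBlock 4 2 4
block4×2 = pairedBlock covering (from-yes (valid? covering))
  where
  open IntegerLiterals
  table : Vec (Vec (Entry 4) 2) 4
  table = from-just (decodeTable 4 (( 1 ∷ -1 ∷ []) ∷
                                    (-2 ∷  2 ∷ []) ∷
                                    (-3 ∷  3 ∷ []) ∷
                                    ( 4 ∷ -4 ∷ []) ∷ []))
  open Table table
  covering : Covering
  covering = from-yes covering?

block6×4 : PairedBlock 6 4 12
block6×4 = pairedBlock covering (from-yes (valid? covering))
  where
  open IntegerLiterals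
  table : Vec (Vec (Entry 12) 4) 6
  table = from-just (decodeTable 12 (( 1 ∷ -1 ∷   6 ∷  -6 ∷ []) ∷
                                     (-2 ∷  2 ∷  -8 ∷   8 ∷ []) ∷
                                     ( 3 ∷ -3 ∷  10 ∷ -10 ∷ []) ∷
                                     (-4 ∷  4 ∷  -9 ∷   9 ∷ []) ∷
                                     (-5 ∷  5 ∷  12 ∷ -12 ∷ []) ∷
                                     ( 7 ∷ -7 ∷ -11 ∷  11 ∷ []) ∷ []))
  open Table table
  covering : Covering
  covering = from-yes covering?

block6×6 : PairedBlock 6 6 18
block6×6 = pairedBlock covering (from-yes (valid? covering))
  where
  open IntegerLiterals
  table : Vec (Vec (Entry 18) 6) 6
  table = from-just (decodeTable 18 (( 12 ∷ -12 ∷   2 ∷ -16 ∷  -2 ∷  16 ∷ []) ∷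
                                     ( -5 ∷   6 ∷  -6 ∷   5 ∷   4 ∷  -4 ∷ []) ∷
                                     ( -7 ∷   7 ∷  18 ∷  -1 ∷ -18 ∷   1 ∷ []) ∷
                                     (-17 ∷ -11 ∷   8 ∷  17 ∷  11 ∷  -8 ∷ []) ∷
                                     (  3 ∷  -3 ∷  -9 ∷  10 ∷ -10 ∷   9 ∷ []) ∷
                                     ( 14 ∷  13 ∷ -13 ∷ -15 ∷  15 ∷ -14 ∷ []) ∷ []))
  open Table table
  covering : Covering
  covering = from-yes covering?

-- Sizes are written p * 2 rather than 2 * p to match the witness of 2 ∣ m.
Grid : ℕ → ℕ → Set
Grid p q = PairedBlock (p * 2) (q * 2) (p * q * 2)

resize : m ≡ m′ → n ≡ n′ → h ≡ h′ → PairedBlock m n h → PairedBlock m′ n′ h′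
resize refl refl refl B = B

grid-beside : ∀ p q₁ q₂ → Grid p q₁ → Grid p q₂ → Grid p (q₁ + q₂)
grid-beside p q₁ q₂ (B₁ , paired₁) (B₂ , paired₂) =
  resize refl (sym (ℕ.*-distribʳ-+ 2 q₁ q₂)) (distrib p q₁ q₂)
         (beside B₁ B₂ , beside-rowPaired B₁ B₂ paired₁ paired₂)
  where
  distrib : ∀ p q₁ q₂ → p * q₁ * 2 + p * q₂ * 2 ≡ p * (q₁ + q₂) * 2
  distrib = solve-∀

grid-above : ∀ p₁ p₂ q → Grid p₁ q → Grid p₂ q → Grid (p₁ + p₂) q
grid-above p₁ p₂ q (B₁ , paired₁) (B₂ , paired₂) =
  resize (sym (ℕ.*-distribʳ-+ 2 p₁ p₂)) refl (distrib p₁ p₂ q)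
         (above B₁ B₂ , above-rowPaired B₁ B₂ paired₁ paired₂)
  where
  distrib : ∀ p₁ p₂ q → p₁ * q * 2 + p₂ * q * 2 ≡ (p₁ + p₂) * q * 2
  distrib = solve-∀

fourRows : ∀ q → Grid 2 (suc q)
fourRows zero    = block4×2
fourRows (suc q) = grid-beside 2 1 (suc q) block4×2 (fourRows q)

sixRows : ∀ q → Grid 3 (2 + q)
sixRows zero          = block6×4
sixRows (suc zero)    = block6×6
sixRows (suc (suc q)) = grid-beside 3 2 (2 + q) block6×4 (sixRows q)

grid : ∀ p q → Grid (2 + p) (2 + q)
grid zero          q = fourRows (suc q)
grid (suc zero)    q = sixRows q
grid (suc (suc p)) q = grid-above 2 (2 + p) (2 + q) (fourRows (suc q)) (grid p q)

toℤ : Entry h → ℤ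
toℤ (true  , k) = + suc (toℕ k)
toℤ (false , k) = -[1+ toℕ k ]

toℤ-injective : (e e′ : Entry h) → toℤ e ≡ toℤ e′ → e ≡ e′
toℤ-injective (true  , k) (true  , k′) eq = cong (true ,_) (toℕ-injective (ℕ.suc-injective (ℤ.+-injective eq)))
toℤ-injective (false , k) (false , k′) eq = cong (false ,_) (toℕ-injective (ℤ.-[1+-injective eq))
toℤ-injective (true  , _) (false , _) ()
toℤ-injective (false , _) (true  , _) ()

toℤ-surjective : ∀ {z} → ¬ z ≡ 0ℤ → ∣ z ∣ ≤ h → Σ (Entry h) λ e → toℤ e ≡ z
toℤ-surjective {z = + zero}   z≢0 _  = ⊥-elim (z≢0 refl)
toℤ-surjective {z = + suc k}  _   lt = (true , Fin.fromℕ< lt) , cong (+_ ∘ suc) (toℕ-fromℕ< lt)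
toℤ-surjective {z = -[1+ k ]} _   lt = (false , Fin.fromℕ< lt) , cong -[1+_] (toℕ-fromℕ< lt)

toℤ-nonzero : (e : Entry h) → ¬ toℤ e ≡ 0ℤ
toℤ-nonzero (true  , _) ()
toℤ-nonzero (false , _) ()

∣toℤ∣≤ : (e : Entry h) → ∣ toℤ e ∣ ≤ h
∣toℤ∣≤ (true  , k) = toℕ<n k
∣toℤ∣≤ (false , k) = toℕ<n k

toℤ-masses : (e : Entry h) → toℤ e ≡ + mass true e ℤ.- + mass false e
toℤ-masses (true  , k) = sym (trans (ℤ.+-identityʳ (+ (suc (toℕ k) + 0))) (cong +_ (ℕ.+-identityʳ (suc (toℕ k)))))
toℤ-masses (false , k) = cong (ℤ.-_ ∘ +_) (sym (ℕ.+-identityʳ (suc (toℕ k))))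

sumℤ-cong : {f g : Vector ℤ n} → f ≗ g → sumℤ f ≡ sumℤ g
sumℤ-cong {n = zero}  f≗g = refl
sumℤ-cong {n = suc n} f≗g = cong₂ ℤ._+_ (f≗g zero) (sumℤ-cong (f≗g ∘ suc))

sumℤ-pos : (f : Vector ℕ n) → sumℤ (+_ ∘ f) ≡ + sum f
sumℤ-pos {n = zero}  f = refl
sumℤ-pos {n = suc n} f = trans (cong (λ s → + f zero ℤ.+ s) (sumℤ-pos (f ∘ suc))) (sym (ℤ.pos-+ (f zero) (sum (f ∘ suc))))

sumℤ-distrib-minus : (f g : Vector ℤ n) → sumℤ (λ i → f i ℤ.- g i) ≡ sumℤ f ℤ.- sumℤ g
sumℤ-distrib-minus {n = zero}  f g = refl
sumℤ-distrib-minus {n = suc n} f g =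
  trans (cong (λ s → f zero ℤ.- g zero ℤ.+ s) (sumℤ-distrib-minus (f ∘ suc) (g ∘ suc)))
        (interchange (f zero) (g zero) (sumℤ (f ∘ suc)) (sumℤ (g ∘ suc)))
  where
  interchange : ∀ a b c d → a ℤ.- b ℤ.+ (c ℤ.- d) ≡ a ℤ.+ c ℤ.- (b ℤ.+ d)
  interchange = ℤSolver.solve-∀

balanced⇒sumℤ≡0 : {v : Vector (Entry h) n} → Balanced v → sumℤ (toℤ ∘ v) ≡ 0ℤ
balanced⇒sumℤ≡0 {v = v} (balanced _ masses) = begin
  sumℤ (toℤ ∘ v)                                                    ≡⟨ sumℤ-cong (toℤ-masses ∘ v) ⟩
  sumℤ (λ i → + mass true (v i) ℤ.- + mass false (v i))             ≡⟨ sumℤ-distrib-minus (+_ ∘ mass true ∘ v) (+_ ∘ mass false ∘ v) ⟩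
  sumℤ (+_ ∘ mass true ∘ v) ℤ.- sumℤ (+_ ∘ mass false ∘ v)          ≡⟨ cong₂ ℤ._-_ (sumℤ-pos (mass true ∘ v)) (sumℤ-pos (mass false ∘ v)) ⟩
  + sum (mass true ∘ v) ℤ.- + sum (mass false ∘ v)                  ≡⟨ cong (λ x → + x ℤ.- + sum (mass false ∘ v)) masses ⟩
  + sum (mass false ∘ v) ℤ.- + sum (mass false ∘ v)                 ≡⟨ ℤ.+-inverseʳ (+ sum (mass false ∘ v)) ⟩
  0ℤ                                                                ∎
  where open ≡-Reasoning

count-true-positive : (e : Entry h) → 0ℤ ℤ.< toℤ e → count true e ≡ 1
count-true-positive (true  , _) _  = refl
count-true-positive (false , _) ()

count-true-nonpositive : (e : Entry h) → ¬ 0ℤ ℤ.< toℤ e → count true e ≡ 0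
count-true-nonpositive (true  , _) ≮ = ⊥-elim (≮ (ℤ.+<+ ℕ.z<s))
count-true-nonpositive (false , _) _ = refl

count-false-negative : (e : Entry h) → toℤ e ℤ.< 0ℤ → count false e ≡ 1
count-false-negative (true  , _) (ℤ.+<+ ())
count-false-negative (false , _) _ = refl

count-false-nonnegative : (e : Entry h) → ¬ toℤ e ℤ.< 0ℤ → count false e ≡ 0
count-false-nonnegative (true  , _) _ = refl
count-false-nonnegative (false , _) ≮ = ⊥-elim (≮ ℤ.-<+)

#pos-toℤ : (v : Vector (Entry h) n) → #pos (toℤ ∘ v) ≡ sum (count true ∘ v)
#pos-toℤ {n = zero}  v = refl
#pos-toℤ {n = suc n} v with 0ℤ ℤ.<? toℤ (v zero)
... | yes 0<e = cong₂ _+_ (sym (count-true-positive (v zero) 0<e)) (#pos-toℤ (v ∘ suc))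
... | no  0≮e = cong₂ _+_ (sym (count-true-nonpositive (v zero) 0≮e)) (#pos-toℤ (v ∘ suc))

#neg-toℤ : (v : Vector (Entry h) n) → #neg (toℤ ∘ v) ≡ sum (count false ∘ v)
#neg-toℤ {n = zero}  v = refl
#neg-toℤ {n = suc n} v with toℤ (v zero) ℤ.<? 0ℤ
... | yes e<0 = cong₂ _+_ (sym (count-false-negative (v zero) e<0)) (#neg-toℤ (v ∘ suc))
... | no  e≮0 = cong₂ _+_ (sym (count-false-nonnegative (v zero) e≮0)) (#neg-toℤ (v ∘ suc))

balanced⇒#pos≡#neg : {v : Vector (Entry h) n} → Balanced v → #pos (toℤ ∘ v) ≡ #neg (toℤ ∘ v)
balanced⇒#pos≡#neg {v = v} (balanced counts _) = trans (#pos-toℤ v) (trans counts (sym (#neg-toℤ v)))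

array : Block m n h → Array m n
array B i j = toℤ (entry B i j)

array-isSMA : (B : Block m n h) → 2 ∣ m * n → (m * n) / 2 ≡ h → IsSMA m n (array B)
array-isSMA B 2∣mn refl = record
  { mn-even    = 2∣mn
  ; entries-in = λ i j → toℤ-nonzero (entry B i j) , ∣toℤ∣≤ (entry B i j)
  ; injective  = λ i j i′ j′ eq → ,-injective (begin
      (i , j)                    ≡⟨ sym (position-entry B i j) ⟩
      position B (entry B i j)   ≡⟨ cong (position B) (toℤ-injective _ _ eq) ⟩
      position B (entry B i′ j′) ≡⟨ position-entry B i′ j′ ⟩
      (i′ , j′)                  ∎)
  ; covers     = λ z (z≢0 , ∣z∣≤) → let (e , e≡z) = toℤ-surjective z≢0 ∣z∣≤ in
                   row B e , column B e , trans (cong toℤ (entry-position B e)) e≡z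
  ; row-sum    = balanced⇒sumℤ≡0 ∘ row-balanced B
  ; col-sum    = balanced⇒sumℤ≡0 ∘ column-balanced B
  }
  where open ≡-Reasoning

array-shiftable : (B : Block m n h) → IsShiftable (array B)
array-shiftable B = balanced⇒#pos≡#neg ∘ row-balanced B , balanced⇒#pos≡#neg ∘ column-balanced B

array-sameRow : (B : Block m n h) → RowPaired B → ∀ x → 1 ≤ x → x ≤ h →
                ∃[ i ] ∃[ j ] ∃[ j′ ] ((array B i j ≡ + x) × (array B i j′ ≡ - (+ x)))
array-sameRow B paired (suc k) _ k<h =
  row B positive , column B positive , column B negative ,
  trans (cong toℤ (entry-position B positive)) (cong (+_ ∘ suc) (toℕ-fromℕ< k<h)) ,
  (begin
    array B (row B positive) (column B negative)  ≡⟨ cong (λ i → array B i (column B negative)) (paired k′) ⟩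
    toℤ (uncurry (entry B) (position B negative)) ≡⟨ cong toℤ (entry-position B negative) ⟩
    -[1+ toℕ k′ ]                                 ≡⟨ cong -[1+_] (toℕ-fromℕ< k<h) ⟩
    -[1+ k ]                                      ∎)
  where
  open ≡-Reasoning
  k′ = Fin.fromℕ< k<h
  positive negative : Entry _
  positive = true , k′
  negative = false , k′

PairedShiftableSMA : ℕ → ℕ → Set
PairedShiftableSMA m n =
  Σ (Array m n) λ A → IsSMA m n A × IsShiftable A ×
    (∀ (x : ℕ) → 1 ≤ x → x ≤ (m * n) / 2 → ∃[ i ] ∃[ j ] ∃[ j′ ] ((A i j ≡ + x) × (A i j′ ≡ - (+ x))))

realise : 2 ∣ m * n → (m * n) / 2 ≡ h → PairedBlock m n h → PairedShiftableSMA m n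
realise 2∣mn refl (B , paired) = array B , array-isSMA B 2∣mn refl , array-shiftable B , array-sameRow B paired

grid-≥2 : ∀ {p q} → 2 ≤ p → 2 ≤ q → Grid p q
grid-≥2 {suc (suc p)} {suc (suc q)} (s≤s (s≤s _)) (s≤s (s≤s _)) = grid p q

half-area : ∀ p q → p * 2 * (q * 2) / 2 ≡ p * q * 2
half-area p q = trans (cong (_/ 2) (rearrange p q)) (m*n/n≡m (p * q * 2) 2)
  where
  rearrange : ∀ p q → p * 2 * (q * 2) ≡ p * q * 2 * 2
  rearrange = solve-∀

theorem2p1 : (m n : ℕ) → 4 ≤ m → 4 ≤ n → 2 ∣ m → 2 ∣ n →
    Σ (Array m n) λ A → IsSMA m n A × IsShiftable A ×
    (∀ (x : ℕ) → 1 ≤ x → x ≤ (m * n) / 2 →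
    ∃[ i ] ∃[ j ] ∃[ j′ ] ((A i j ≡ + x) × (A i j′ ≡ - (+ x))))
theorem2p1 _ _ 4≤m 4≤n 2∣m@(divides p refl) (divides q refl) =
  realise (∣m⇒∣m*n (q * 2) 2∣m) (half-area p q) (grid-≥2 (ℕ.*-cancelʳ-≤ 2 p 2 4≤m) (ℕ.*-cancelʳ-≤ 2 q 2 4≤n))
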